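{- Let $T=(\mathcal M,\mathcal E)$ be a clique tree of a chordal claw-free graph $G=(V,E)$. Then for every $v\in V$ the induced subtree $T[\mathcal M_v]$ is a path in $T$.
   Context: Graphs are finite simple undirected. A graph is chordal if every cycle of length at least 4 has a chord, and claw-free if it has no induced $K_{1,3}$. A max clique is an inclusion-maximal clique. For a chordal graph $G$ let $\mathcal M$ be its set of max cliques and $\mathcal M_v$ the set of max cliques containing the vertex $v$. A clique tree of $G$ is a tree $T=(\mathcal M,\mathcal E)$ on vertex set $\mathcal M$ such that for every vertex $v$ of $G$ the induced subgraph $T[\mathcal M_v]$ is connected. -}

module Defs where

open import Data.Nat using (ℕ; zero; suc; _≤_)
open import Data.Fin using (Fin; toℕ)
open import Data.Fin.Subset using (Subset; _∈_; _⊆_)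
open import Data.Bool using (Bool; true; false)
open import Data.Product using (Σ; ∃; ∃-syntax; _×_; _,_)
open import Data.Sum using (_⊎_)
open import Data.Unit using (⊤)
open import Relation.Nullary using (¬_)
open import Relation.Binary.PropositionalEquality using (_≡_; _≢_)
open import Function using (_⇔_)
open import Function.Definitions using (Injective)

record Graph (n : ℕ) : Set where
  field
    adj    : Fin n → Fin n → Bool
    sym    : ∀ u v → adj u v ≡ adj v u
    irrefl : ∀ v → adj v v ≡ false
open Graph public

Adj : ∀ {n} → Graph n → Fin n → Fin n → Set
Adj G u v = adj G u v ≡ true

CycConsec : ∀ {k} → Fin k → Fin k → Set
CycConsec {k} i j =
  suc (toℕ i) ≡ toℕ j ⊎ suc (toℕ j) ≡ toℕ i
  ⊎ (toℕ i ≡ 0 × suc (toℕ j) ≡ k) ⊎ (toℕ j ≡ 0 × suc (toℕ i) ≡ k)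

-- A cycle of length k in G: k distinct vertices c 0, ..., c (k-1),
-- with c i adjacent to c (i+1) and c (k-1) adjacent to c 0.
-- (Length constraints k ≥ 3 / k ≥ 4 are imposed where used.)
record Cycle {n} (G : Graph n) (k : ℕ) : Set where
  field
    c      : Fin k → Fin n
    inj    : Injective _≡_ _≡_ c
    edges  : ∀ i j → CycConsec i j → Adj G (c i) (c j)
open Cycle public

HasChord : ∀ {n k} {G : Graph n} → Cycle G k → Set
HasChord {G = G} C =
  ∃[ i ] ∃[ j ] (i ≢ j × ¬ CycConsec i j × Adj G (c C i) (c C j))

Chordal : ∀ {n} → Graph n → Set
Chordal G = ∀ k → 4 ≤ k → (C : Cycle G k) → HasChord C

ClawFree : ∀ {n} → Graph n → Set
ClawFree G = ¬ (∃[ a ] ∃[ b ] ∃[ c ] ∃[ d ]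
  (Adj G a b × Adj G a c × Adj G a d
   × b ≢ c × b ≢ d × c ≢ d
   × ¬ Adj G b c × ¬ Adj G b d × ¬ Adj G c d))

IsClique : ∀ {n} → Graph n → Subset n → Set
IsClique G S = ∀ u v → u ∈ S → v ∈ S → u ≢ v → Adj G u v

IsMaxClique : ∀ {n} → Graph n → Subset n → Set
IsMaxClique G S = IsClique G S × (∀ S′ → IsClique G S′ → S ⊆ S′ → S′ ⊆ S)

-- Walks in a graph whose vertices all satisfy P (walks in the induced
-- subgraph on P).
data WalkIn {m} (T : Graph m) (P : Fin m → Set) : Fin m → Fin m → Set where
  here : ∀ x → P x → WalkIn T P x x
  step : ∀ x y z → P x → Adj T x y → WalkIn T P y z → WalkIn T P x z

Connected : ∀ {m} → Graph m → Set
Connected T = ∀ i j → WalkIn T (λ _ → ⊤) i j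

IsTree : ∀ {m} → Graph m → Set
IsTree T = Connected T × (∀ k → 3 ≤ k → ¬ Cycle T k)

-- A clique tree of G: the max cliques of G are enumerated without
-- repetition as K 0, ..., K (m-1) (so Fin m stands for ℳ), T is a tree on
-- them, and for every vertex v the induced subgraph T[ℳ_v] is connected.
record CliqueTree {n} (G : Graph n) : Set where
  field
    m         : ℕ
    K         : Fin m → Subset n
    K-inj     : Injective _≡_ _≡_ K
    K-max     : ∀ i → IsMaxClique G (K i)
    K-all     : ∀ S → IsMaxClique G S → ∃[ i ] K i ≡ S
    T         : Graph m
    T-tree    : IsTree T
    T-induced : ∀ v i j → v ∈ K i → v ∈ K j → WalkIn T (λ l → v ∈ K l) i j
open CliqueTree public

InducedPath : ∀ {m} → Graph m → (Fin m → Set) → Set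
InducedPath T P =
  ∃[ ℓ ] Σ (Fin ℓ → _) λ f →
    Injective _≡_ _≡_ f
    × (∀ i → P i ⇔ (∃[ s ] f s ≡ i))
    × (∀ s t → Adj T (f s) (f t) ⇔ (suc (toℕ s) ≡ toℕ t ⊎ suc (toℕ t) ≡ toℕ s))

module Submission where

-- Fix v and let P i mean v ∈ K i; by the clique-tree property T[P] is
-- connected.  Claw argument: no node x of T[P] has three neighbours
-- y₁, y₂, y₃ in T[P].  Pick bᵢ ∈ K yᵢ ∖ K x; v is adjacent to each bᵢ
-- (both lie in K yᵢ).  Removing x separates the yᵢ in the tree, and the
-- max cliques containing a vertex form a subtree, so no max clique
-- contains two of the bᵢ; as every edge lies in a max clique, v, b₁, b₂,
-- b₃ is a claw.  Tree argument: a connected part of an acyclic graph of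
-- maximum degree two is an induced path: grow a simple path while some
-- vertex is missed (a leaving edge must start at an end of the path), and
-- a spanning simple path is induced since a chord would close a cycle.

open import Defs hiding (sym)
open import Data.Nat using (ℕ; zero; suc; _+_; _∸_; _≤_; _<_; z≤n; s≤s; s≤s⁻¹; _≟_)
open import Data.Nat.Properties
open import Data.Fin using (Fin; toℕ; fromℕ<)
open import Data.Fin.Properties using (any?; all?; pigeonhole; toℕ<n; toℕ-injective; toℕ-fromℕ<)
  renaming (_≟_ to _≟ᶠ_)
open import Data.Fin.Subset using (Subset; _∈_; _∉_; _⊆_; _∪_; ⁅_⁆; ∣_∣)
open import Data.Fin.Subset.Properties
  using (_∈?_; x∈p∪q⁻; x∈p∪q⁺; x∈⁅x⁆; x∈⁅y⁆⇒x≡y; p⊂q⇒∣p∣<∣q∣; ∣p∣≤n; p⊆p∪q; ⊆-antisym)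
open import Data.Bool using (true) renaming (_≟_ to _≟ᵇ_)
open import Data.Product using (Σ; ∃₂; ∃-syntax; _×_; _,_; proj₁; proj₂)
open import Data.Sum using (_⊎_; inj₁; inj₂)
open import Data.Unit using (⊤; tt)
open import Data.Empty using (⊥; ⊥-elim)
open import Relation.Nullary using (¬_; yes; no; Dec; ¬?; _×-dec_; _→-dec_)
open import Relation.Nullary.Decidable using (map′; decidable-stable)
open import Relation.Binary using (tri<; tri≈; tri>)
open import Relation.Binary.PropositionalEquality
  using (_≡_; _≢_; refl; trans; cong; subst; subst₂; module ≡-Reasoning) renaming (sym to ≡-sym)
open import Function using (_∘_; id)
open import Function.Bundles using (_⇔_; mk⇔)

module _ {n : ℕ} (G : Graph n) where

  adj-sym : ∀ {a b} → Adj G a b → Adj G b a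
  adj-sym {a} {b} ab = trans (Graph.sym G b a) ab

  adj⇒≢ : ∀ {a b} → Adj G a b → a ≢ b
  adj⇒≢ {a} loop refl with trans (≡-sym loop) (irrefl G a)
  ... | ()

  adj? : ∀ a b → Dec (Adj G a b)
  adj? a b = adj G a b ≟ᵇ true

Acyclic : ∀ {m} → Graph m → Set
Acyclic T = ∀ k → 3 ≤ k → ¬ Cycle T k

MaxDegreeTwo : ∀ {m} → Graph m → (Fin m → Set) → Set
MaxDegreeTwo T P = ∀ x y₁ y₂ y₃ → y₁ ≢ y₂ → y₁ ≢ y₃ → y₂ ≢ y₃
  → P x → P y₁ → P y₂ → P y₃ → Adj T x y₁ → Adj T x y₂ → Adj T x y₃ → ⊥

module Paths {m : ℕ} (T : Graph m) where

  walkStart : ∀ {P a b} → WalkIn T P a b → P a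
  walkStart (here _ pa) = pa
  walkStart (step _ _ _ pa _ _) = pa

  _++ʷ_ : ∀ {P a b c} → WalkIn T P a b → WalkIn T P b c → WalkIn T P a c
  here _ _ ++ʷ w′ = w′
  step x y _ px xy w ++ʷ w′ = step x y _ px xy (w ++ʷ w′)

  mapWalk : ∀ {P Q a b} → (∀ {u} → P u → Q u) → WalkIn T P a b → WalkIn T Q a b
  mapWalk f (here x px) = here x (f px)
  mapWalk f (step x y z px xy w) = step x y z (f px) xy (mapWalk f w)

  -- A simple path vtx 0, …, vtx len from a to b inside T[Q].  It is indexed
  -- by ℕ to keep the index arithmetic light; only indices ≤ len matter.
  record SPath (Q : Fin m → Set) (a b : Fin m) : Set where
    field
      len       : ℕ
      vtx       : ℕ → Fin m
      start     : vtx 0 ≡ a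
      end       : vtx len ≡ b
      inQ       : ∀ s → s ≤ len → Q (vtx s)
      injective : ∀ s t → s ≤ len → t ≤ len → vtx s ≡ vtx t → s ≡ t
      linked    : ∀ s → s < len → Adj T (vtx s) (vtx (suc s))
  open SPath public

  Visits : ∀ {Q a b} → SPath Q a b → Fin m → Set
  Visits Π u = ∃[ k ] (k ≤ len Π × vtx Π k ≡ u)

  visits? : ∀ {Q a b} (Π : SPath Q a b) u → Dec (Visits Π u)
  visits? Π u = map′ (λ (k , k<1+len , e) → k , s≤s⁻¹ k<1+len , e)
                     (λ (k , k≤len , e) → k , s≤s k≤len , e)
                     (anyUpTo? (λ k → vtx Π k ≟ᶠ u) (suc (len Π)))

  consecutive⇒adjacent : ∀ {Q a b} (Π : SPath Q a b) s t → t ≤ len Π → suc s ≡ t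
                       → Adj T (vtx Π s) (vtx Π t)
  consecutive⇒adjacent Π s t t≤len refl = linked Π s t≤len

  len<m : ∀ {Q a b} (Π : SPath Q a b) → len Π < m
  len<m Π = ≰⇒> λ m≤len →
    let (i , j , i<j , same) = pigeonhole (s≤s m≤len) (λ k → vtx Π (toℕ k))
    in <⇒≢ i<j (injective Π _ _ (s≤s⁻¹ (toℕ<n i)) (s≤s⁻¹ (toℕ<n j)) same)

  single : ∀ {Q} x → Q x → SPath Q x x
  single x qx = record
    { len = 0 ; vtx = λ _ → x ; start = refl ; end = refl ; inQ = λ _ _ → qx
    ; injective = λ { zero zero _ _ _ → refl } ; linked = λ _ () }

  weaken : ∀ {Q Q′ a b} → (∀ {u} → Q u → Q′ u) → SPath Q a b → SPath Q′ a b
  weaken f Π = record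
    { len = len Π ; vtx = vtx Π ; start = start Π ; end = end Π
    ; inQ = λ s s≤len → f (inQ Π s s≤len)
    ; injective = injective Π ; linked = linked Π }

  cons : ∀ {Q y z} x → Q x → Adj T x y → (Π : SPath Q y z) → ¬ Visits Π x → SPath Q x z
  cons {Q} x qx xy Π x∉Π = record
    { len = suc (len Π) ; vtx = vtx′ ; start = refl ; end = end Π
    ; inQ = inQ′ ; injective = injective′ ; linked = linked′ }
    where
    vtx′ : ℕ → Fin m
    vtx′ zero = x
    vtx′ (suc i) = vtx Π i
    inQ′ : ∀ s → s ≤ suc (len Π) → Q (vtx′ s)
    inQ′ zero _ = qx
    inQ′ (suc s) (s≤s s≤len) = inQ Π s s≤len
    injective′ : ∀ s t → s ≤ suc (len Π) → t ≤ suc (len Π) → vtx′ s ≡ vtx′ t → s ≡ t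
    injective′ zero zero _ _ _ = refl
    injective′ zero (suc t) _ (s≤s t≤len) e = ⊥-elim (x∉Π (t , t≤len , ≡-sym e))
    injective′ (suc s) zero (s≤s s≤len) _ e = ⊥-elim (x∉Π (s , s≤len , e))
    injective′ (suc s) (suc t) (s≤s s≤len) (s≤s t≤len) e =
      cong suc (injective Π s t s≤len t≤len e)
    linked′ : ∀ s → s < suc (len Π) → Adj T (vtx′ s) (vtx′ (suc s))
    linked′ zero _ = subst (Adj T x) (≡-sym (start Π)) xy
    linked′ (suc s) (s≤s s<len) = linked Π s s<len

  drop : ∀ {Q a b} (Π : SPath Q a b) k → k ≤ len Π → SPath Q (vtx Π k) b
  drop Π k k≤len = record
    { len = len Π ∸ k ; vtx = λ i → vtx Π (k + i)
    ; start = cong (vtx Π) (+-identityʳ k)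
    ; end = trans (cong (vtx Π) (m+[n∸m]≡n k≤len)) (end Π)
    ; inQ = λ s s≤ → inQ Π (k + s) (shift s≤)
    ; injective = λ s t s≤ t≤ e →
        +-cancelˡ-≡ k s t (injective Π (k + s) (k + t) (shift s≤) (shift t≤) e)
    ; linked = λ s s< →
        subst (Adj T (vtx Π (k + s))) (cong (vtx Π) (≡-sym (+-suc k s)))
          (linked Π (k + s) (subst (_≤ len Π) (+-suc k s) (shift s<))) }
    where
    shift : ∀ {s} → s ≤ len Π ∸ k → k + s ≤ len Π
    shift s≤ = subst (k + _ ≤_) (m+[n∸m]≡n k≤len) (+-monoʳ-≤ k s≤)

  reverse : ∀ {Q a b} → SPath Q a b → SPath Q b a
  reverse Π = record
    { len = len Π ; vtx = λ i → vtx Π (len Π ∸ i) ; start = end Π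
    ; end = trans (cong (vtx Π) (n∸n≡0 (len Π))) (start Π)
    ; inQ = λ s _ → inQ Π (len Π ∸ s) (m∸n≤m (len Π) s)
    ; injective = λ s t s≤ t≤ e → begin
        s                     ≡⟨ ≡-sym (m∸[m∸n]≡n s≤) ⟩
        len Π ∸ (len Π ∸ s)   ≡⟨ cong (len Π ∸_) (injective Π _ _ (m∸n≤m _ s) (m∸n≤m _ t) e) ⟩
        len Π ∸ (len Π ∸ t)   ≡⟨ m∸[m∸n]≡n t≤ ⟩
        t                     ∎
    ; linked = linked′ }
    where
    open ≡-Reasoning
    linked′ : ∀ s → s < len Π → Adj T (vtx Π (len Π ∸ s)) (vtx Π (len Π ∸ suc s))
    linked′ s s<len = adj-sym T (subst (Adj T _) (cong (vtx Π) (≡-sym e)) (linked Π _ before))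
      where
      e : len Π ∸ s ≡ suc (len Π ∸ suc s)
      e = +-∸-assoc 1 s<len
      before : len Π ∸ suc s < len Π
      before = subst (_≤ len Π) e (m∸n≤m (len Π) s)

  shortcut : ∀ {Q a b} → WalkIn T Q a b → SPath Q a b
  shortcut (here x qx) = single x qx
  shortcut (step x y z qx xy w) with visits? (shortcut w) x
  ... | yes (k , k≤len , vk≡x) = subst (λ u → SPath _ u z) vk≡x (drop (shortcut w) k k≤len)
  ... | no x∉Π = cons x qx xy (shortcut w) x∉Π

module Forest {m : ℕ} (T : Graph m) (acyclic : Acyclic T) where
  open Paths T

  -- A simple path vtx 0, …, vtx k with k ≥ 2 has no edge vtx 0 — vtx k:
  -- it would close a cycle of length k + 1.
  noChordFromStart : ∀ {Q a b} (Π : SPath Q a b) k → 2 ≤ k → k ≤ len Π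
                   → ¬ Adj T (vtx Π 0) (vtx Π k)
  noChordFromStart Π k 2≤k k≤len chord = acyclic (suc k) (s≤s 2≤k) cycle
    where
    bound : (i : Fin (suc k)) → toℕ i ≤ len Π
    bound i = ≤-trans (s≤s⁻¹ (toℕ<n i)) k≤len
    forward : ∀ i j → suc (toℕ i) ≡ toℕ j → Adj T (vtx Π (toℕ i)) (vtx Π (toℕ j))
    forward i j = consecutive⇒adjacent Π (toℕ i) (toℕ j) (bound j)
    closing : ∀ i j → toℕ i ≡ 0 → suc (toℕ j) ≡ suc k → Adj T (vtx Π (toℕ i)) (vtx Π (toℕ j))
    closing i j i≡0 j≡k = subst₂ (λ s t → Adj T (vtx Π s) (vtx Π t))
                                 (≡-sym i≡0) (≡-sym (suc-injective j≡k)) chord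
    cycleEdges : ∀ i j → CycConsec i j → Adj T (vtx Π (toℕ i)) (vtx Π (toℕ j))
    cycleEdges i j (inj₁ e) = forward i j e
    cycleEdges i j (inj₂ (inj₁ e)) = adj-sym T (forward j i e)
    cycleEdges i j (inj₂ (inj₂ (inj₁ (i≡0 , j≡k)))) = closing i j i≡0 j≡k
    cycleEdges i j (inj₂ (inj₂ (inj₂ (j≡0 , i≡k)))) = adj-sym T (closing j i j≡0 i≡k)
    cycle : Cycle T (suc k)
    cycle = record
      { c = λ i → vtx Π (toℕ i)
      ; inj = λ {i} {j} e → toℕ-injective (injective Π _ _ (bound i) (bound j) e)
      ; edges = cycleEdges }

  forwardAdjacent⇒consecutive : ∀ {Q a b} (Π : SPath Q a b) s t → s < t → t ≤ len Π
                              → Adj T (vtx Π s) (vtx Π t) → suc s ≡ t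
  forwardAdjacent⇒consecutive Π s t s<t t≤len st with suc s ≟ t
  ... | yes e = e
  ... | no 1+s≢t = ⊥-elim (noChordFromStart (drop Π s s≤len) (t ∸ s) far (∸-monoˡ-≤ s t≤len) chord)
    where
    s≤len : s ≤ len Π
    s≤len = ≤-trans (<⇒≤ s<t) t≤len
    far : 2 ≤ t ∸ s
    far = m+n≤o⇒m≤o∸n 2 (≤∧≢⇒< s<t 1+s≢t)
    chord : Adj T (vtx Π (s + 0)) (vtx Π (s + (t ∸ s)))
    chord = subst₂ (λ i j → Adj T (vtx Π i) (vtx Π j))
                   (≡-sym (+-identityʳ s)) (≡-sym (m+[n∸m]≡n (<⇒≤ s<t))) st

  onlyConsecutiveAdjacent : ∀ {Q a b} (Π : SPath Q a b) s t → s ≤ len Π → t ≤ len Π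
                          → Adj T (vtx Π s) (vtx Π t) → suc s ≡ t ⊎ suc t ≡ s
  onlyConsecutiveAdjacent Π s t s≤len t≤len st with <-cmp s t
  ... | tri< s<t _ _ = inj₁ (forwardAdjacent⇒consecutive Π s t s<t t≤len st)
  ... | tri≈ _ refl _ = ⊥-elim (adj⇒≢ T st refl)
  ... | tri> _ _ t<s = inj₂ (forwardAdjacent⇒consecutive Π t s t<s s≤len (adj-sym T st))

  -- A node x separates any two distinct neighbours y, y′: a walk between
  -- them avoiding x, together with x, would contain a cycle.
  separates : ∀ {x y y′} → Adj T x y → Adj T x y′ → y ≢ y′ → ¬ WalkIn T (_≢ x) y y′
  separates {x} {y} {y′} xy xy′ y≢y′ w =
    noChordFromStart throughX (suc (len Π)) (s≤s (n≢0⇒n>0 nonTrivial)) ≤-refl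
      (subst (Adj T x) (≡-sym (end Π)) xy′)
    where
    Π : SPath (_≢ x) y y′
    Π = shortcut w
    nonTrivial : len Π ≢ 0
    nonTrivial len≡0 = y≢y′ (trans (≡-sym (start Π)) (trans (cong (vtx Π) (≡-sym len≡0)) (end Π)))
    throughX : SPath (λ _ → ⊤) x y′
    throughX = cons x tt xy (weaken (λ _ → tt) Π) (λ (k , k≤len , vk≡x) → inQ Π k k≤len vk≡x)

  spanning⇒InducedPath : ∀ {P a b} (Π : SPath P a b) → (∀ u → P u → Visits Π u)
                       → InducedPath T P
  spanning⇒InducedPath {P} Π spans = suc (len Π) , f , f-injective , members , adjacency
    where
    f : Fin (suc (len Π)) → Fin m
    f s = vtx Π (toℕ s)
    bound : ∀ s → toℕ s ≤ len Π
    bound s = s≤s⁻¹ (toℕ<n s)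
    f-injective : ∀ {s t} → f s ≡ f t → s ≡ t
    f-injective {s} {t} e = toℕ-injective (injective Π _ _ (bound s) (bound t) e)
    listed : ∀ {i} → Visits Π i → ∃[ s ] f s ≡ i
    listed (k , k≤len , e) = fromℕ< (s≤s k≤len) , trans (cong (vtx Π) (toℕ-fromℕ< (s≤s k≤len))) e
    members : ∀ i → P i ⇔ (∃[ s ] f s ≡ i)
    members i = mk⇔ (listed ∘ spans i) (λ (s , e) → subst P e (inQ Π (toℕ s) (bound s)))
    adjacency : ∀ s t → Adj T (f s) (f t) ⇔ (suc (toℕ s) ≡ toℕ t ⊎ suc (toℕ t) ≡ toℕ s)
    adjacency s t = mk⇔ (onlyConsecutiveAdjacent Π (toℕ s) (toℕ t) (bound s) (bound t)) λ where
      (inj₁ e) → consecutive⇒adjacent Π _ _ (bound t) e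
      (inj₂ e) → adj-sym T (consecutive⇒adjacent Π _ _ (bound s) e)

emptyInducedPath : ∀ {m} (T : Graph m) {P : Fin m → Set} → (∀ i → ¬ P i) → InducedPath T P
emptyInducedPath T none =
  0 , (λ ()) , (λ { {()} }) , (λ i → mk⇔ (⊥-elim ∘ none i) λ { (() , _) }) , λ ()

module BranchFree {m : ℕ} (T : Graph m) (acyclic : Acyclic T)
  (P : Fin m → Set) (P? : ∀ u → Dec (P u))
  (connected : ∀ i j → P i → P j → WalkIn T P i j)
  (maxDegreeTwo : MaxDegreeTwo T P) where
  open Paths T
  open Forest T acyclic

  Longer : ∀ {a b} → SPath P a b → Set
  Longer Π = ∃₂ λ a′ b′ → Σ (SPath P a′ b′) λ Π′ → len Π′ ≡ suc (len Π)

  prepend : ∀ {a b w} (Π : SPath P a b) → P w → ¬ Visits Π w → Adj T (vtx Π 0) w → Longer Π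
  prepend Π pw off adjacent =
    _ , _ , cons _ pw (subst (Adj T _) (start Π) (adj-sym T adjacent)) Π off , refl

  -- An edge from the k-th vertex of Π to a P-vertex w off Π extends Π when
  -- k is an end of Π; for interior k, vtx Π k would have three neighbours.
  extendAt : ∀ {a b w} (Π : SPath P a b) k → k ≤ len Π → P w → ¬ Visits Π w
           → Adj T (vtx Π k) w → Longer Π
  extendAt Π zero _ pw off adjacent = prepend Π pw off adjacent
  extendAt {w = w} Π (suc j) k≤len pw off adjacent with suc j ≟ len Π
  ... | yes atEnd = prepend (reverse Π) pw offReversed
                      (subst (λ t → Adj T (vtx Π t) w) atEnd adjacent)
    where
    offReversed : ¬ Visits (reverse Π) w
    offReversed (k , k≤len , e) = off (len Π ∸ k , m∸n≤m (len Π) k , e)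
  ... | no inInterior = ⊥-elim (maxDegreeTwo (vtx Π (suc j)) (vtx Π j) (vtx Π (suc (suc j))) w
          (λ e → <⇒≢ (m≤n⇒m≤1+n (n<1+n j)) (injective Π _ _ j≤len 2+j≤len e))
          (λ e → off (j , j≤len , e)) (λ e → off (suc (suc j) , 2+j≤len , e))
          (inQ Π (suc j) k≤len) (inQ Π j j≤len) (inQ Π (suc (suc j)) 2+j≤len) pw
          (adj-sym T (linked Π j k≤len)) (linked Π (suc j) 2+j≤len) adjacent)
    where
    j≤len : j ≤ len Π
    j≤len = ≤-trans (n≤1+n j) k≤len
    2+j≤len : suc (suc j) ≤ len Π
    2+j≤len = ≤∧≢⇒< k≤len inInterior

  leave : ∀ {a b s u} (Π : SPath P a b) → WalkIn T P s u → Visits Π s → ¬ Visits Π u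
        → ∃₂ λ w w′ → Visits Π w × ¬ Visits Π w′ × P w′ × Adj T w w′
  leave Π (here _ _) on off = ⊥-elim (off on)
  leave Π (step x y _ _ xy w) on off with visits? Π y
  ... | yes onY = leave Π w onY off
  ... | no offY = x , y , on , offY , walkStart w , xy

  spanOrExtend : ∀ {a b} (Π : SPath P a b) → (∀ u → P u → Visits Π u) ⊎ Longer Π
  spanOrExtend Π with any? (λ u → P? u ×-dec ¬? (visits? Π u))
  ... | no noneMissed = inj₁ λ u pu → decidable-stable (visits? Π u) (λ off → noneMissed (u , pu , off))
  ... | yes (u , pu , off) with leave Π (connected _ u (inQ Π 0 z≤n) pu) (0 , z≤n , refl) off
  ... | _ , _ , (k , k≤len , refl) , off′ , pw′ , ww′ = inj₂ (extendAt Π k k≤len pw′ off′ ww′)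

  -- Extending at most m times produces a spanning, hence induced, path.
  grow : ∀ fuel {a b} (Π : SPath P a b) → m ≤ len Π + fuel → InducedPath T P
  grow zero Π bound = ⊥-elim (<⇒≱ (len<m Π) (subst (m ≤_) (+-identityʳ _) bound))
  grow (suc fuel) Π bound with spanOrExtend Π
  ... | inj₁ spans = spanning⇒InducedPath Π spans
  ... | inj₂ (_ , _ , Π′ , longer) =
    grow fuel Π′ (subst (m ≤_) (trans (+-suc (len Π) fuel) (cong (_+ fuel) (≡-sym longer))) bound)

  inducedPath : InducedPath T P
  inducedPath with any? P?
  ... | yes (i , pi) = grow m (single i pi) ≤-refl
  ... | no none = emptyInducedPath T λ i pi → none (i , pi)

module MaxCliques {n : ℕ} (G : Graph n) where

  singletonClique : ∀ a → IsClique G ⁅ a ⁆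
  singletonClique a x y x∈ y∈ x≢y = ⊥-elim (x≢y (trans (x∈⁅y⁆⇒x≡y a x∈) (≡-sym (x∈⁅y⁆⇒x≡y a y∈))))

  addToClique : ∀ (S : Subset n) u → IsClique G S → (∀ w → w ∈ S → Adj G u w) → IsClique G (S ∪ ⁅ u ⁆)
  addToClique S u clique uS x y x∈ y∈ x≢y with x∈p∪q⁻ S ⁅ u ⁆ x∈ | x∈p∪q⁻ S ⁅ u ⁆ y∈
  ... | inj₁ x∈S | inj₁ y∈S = clique x y x∈S y∈S x≢y
  ... | inj₁ x∈S | inj₂ y∈u rewrite x∈⁅y⁆⇒x≡y u y∈u = adj-sym G (uS x x∈S)
  ... | inj₂ x∈u | inj₁ y∈S rewrite x∈⁅y⁆⇒x≡y u x∈u = uS y y∈S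
  ... | inj₂ x∈u | inj₂ y∈u = singletonClique u x y x∈u y∈u x≢y

  maximalOrAddable : ∀ (S : Subset n) → (∀ S′ → IsClique G S′ → S ⊆ S′ → S′ ⊆ S)
                         ⊎ ∃[ u ] (u ∉ S × (∀ w → w ∈ S → Adj G u w))
  maximalOrAddable S with any? (λ u → ¬? (u ∈? S) ×-dec all? (λ w → (w ∈? S) →-dec adj? G u w))
  ... | yes addable = inj₂ addable
  ... | no noneAddable = inj₁ maximal
    where
    maximal : ∀ S′ → IsClique G S′ → S ⊆ S′ → S′ ⊆ S
    maximal S′ clique′ S⊆S′ {x} x∈S′ = decidable-stable (x ∈? S) λ x∉S →
      noneAddable (x , x∉S , λ w w∈S →
        clique′ x w x∈S′ (S⊆S′ w∈S) (λ x≡w → x∉S (subst (_∈ S) (≡-sym x≡w) w∈S)))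

  addingGrows : ∀ (S : Subset n) u → u ∉ S → ∣ S ∣ < ∣ S ∪ ⁅ u ⁆ ∣
  addingGrows S u u∉S = p⊂q⇒∣p∣<∣q∣ (p⊆p∪q ⁅ u ⁆ , u , x∈p∪q⁺ (inj₂ (x∈⁅x⁆ u)) , u∉S)

  -- Every clique extends to a max clique: keep adding vertices; since the
  -- size grows each time and stays ≤ n, fuel n suffices.
  extendToMax : ∀ fuel (S : Subset n) → IsClique G S → n ≤ ∣ S ∣ + fuel
              → ∃[ S′ ] (IsMaxClique G S′ × S ⊆ S′)
  extendToMax fuel S clique bound with maximalOrAddable S
  ... | inj₁ maximal = S , (clique , maximal) , id
  extendToMax zero S clique bound | inj₂ (u , u∉S , _) =
    ⊥-elim (<⇒≱ (<-≤-trans (addingGrows S u u∉S) (∣p∣≤n (S ∪ ⁅ u ⁆))) (subst (n ≤_) (+-identityʳ _) bound))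
  extendToMax (suc fuel) S clique bound | inj₂ (u , u∉S , uS)
    with extendToMax fuel (S ∪ ⁅ u ⁆) (addToClique S u clique uS) bound′
    where
    bound′ : n ≤ ∣ S ∪ ⁅ u ⁆ ∣ + fuel
    bound′ = ≤-trans bound (subst (_≤ ∣ S ∪ ⁅ u ⁆ ∣ + fuel) (≡-sym (+-suc _ fuel))
                              (+-monoˡ-≤ fuel (addingGrows S u u∉S)))
  ... | S′ , maximal , S∪u⊆S′ = S′ , maximal , S∪u⊆S′ ∘ p⊆p∪q ⁅ u ⁆

  edgeInMaxClique : ∀ a b → Adj G a b → ∃[ S ] (IsMaxClique G S × a ∈ S × b ∈ S)
  edgeInMaxClique a b ab with extendToMax n (⁅ a ⁆ ∪ ⁅ b ⁆) pair (m≤n+m n _)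
    where
    pair : IsClique G (⁅ a ⁆ ∪ ⁅ b ⁆)
    pair = addToClique ⁅ a ⁆ b (singletonClique a)
             (λ w w∈ → subst (Adj G b) (≡-sym (x∈⁅y⁆⇒x≡y a w∈)) (adj-sym G ab))
  ... | S , maximal , sub = S , maximal , sub (x∈p∪q⁺ (inj₁ (x∈⁅x⁆ a))) , sub (x∈p∪q⁺ (inj₂ (x∈⁅x⁆ b)))

module InCliqueTree {n : ℕ} (G : Graph n) (CT : CliqueTree G) where
  open Paths (T CT)
  open Forest (T CT) (proj₂ (T-tree CT))
  open MaxCliques G

  -- Distinct max cliques are incomparable: K y has a vertex outside K x.
  outside : ∀ x y → y ≢ x → ∃[ a ] (a ∈ K CT y × a ∉ K CT x)
  outside x y y≢x with any? (λ a → (a ∈? K CT y) ×-dec ¬? (a ∈? K CT x))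
  ... | yes found = found
  ... | no none = ⊥-elim (y≢x (K-inj CT (⊆-antisym Ky⊆Kx
                    (proj₂ (K-max CT y) (K CT x) (proj₁ (K-max CT x)) Ky⊆Kx))))
    where
    Ky⊆Kx : K CT y ⊆ K CT x
    Ky⊆Kx {a} a∈y = decidable-stable (a ∈? K CT x) (λ a∉x → none (a , a∈y , a∉x))

  -- For distinct tree neighbours y, y′ of x, no max clique K z contains
  -- both a ∈ K y ∖ K x and a′ ∈ K y′ ∖ K x: the subtrees of a and a′ would
  -- give a walk from y to y′ through z avoiding x, which x separates.
  separated : ∀ x y y′ a a′ → Adj (T CT) x y → Adj (T CT) x y′ → y ≢ y′
            → a ∈ K CT y → a ∉ K CT x → a′ ∈ K CT y′ → a′ ∉ K CT x
            → ∀ z → a ∈ K CT z → a′ ∈ K CT z → ⊥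
  separated x y y′ a a′ xy xy′ y≢y′ a∈y a∉x a′∈y′ a′∉x z a∈z a′∈z =
    separates xy xy′ y≢y′ (avoiding a∉x (T-induced CT a y z a∈y a∈z)
                           ++ʷ avoiding a′∉x (T-induced CT a′ z y′ a′∈z a′∈y′))
    where
    avoiding : ∀ {b i j} → b ∉ K CT x → WalkIn (T CT) (λ l → b ∈ K CT l) i j
             → WalkIn (T CT) (_≢ x) i j
    avoiding b∉x = mapWalk (λ b∈l l≡x → b∉x (subst (λ l → _ ∈ K CT l) l≡x b∈l))

  noBranchPoint : ClawFree G → ∀ v → MaxDegreeTwo (T CT) (λ i → v ∈ K CT i)
  noBranchPoint clawFree v x y₁ y₂ y₃ y₁≢y₂ y₁≢y₃ y₂≢y₃ v∈x v∈y₁ v∈y₂ v∈y₃ xy₁ xy₂ xy₃ =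
    clawFree (v , b y₁ xy₁ , b y₂ xy₂ , b y₃ xy₃
             , vAdj y₁ xy₁ v∈y₁ , vAdj y₂ xy₂ v∈y₂ , vAdj y₃ xy₃ v∈y₃
             , distinct y₁ y₂ xy₁ xy₂ y₁≢y₂ , distinct y₁ y₃ xy₁ xy₃ y₁≢y₃
             , distinct y₂ y₃ xy₂ xy₃ y₂≢y₃
             , nonAdjacent y₁ y₂ xy₁ xy₂ y₁≢y₂ , nonAdjacent y₁ y₃ xy₁ xy₃ y₁≢y₃
             , nonAdjacent y₂ y₃ xy₂ xy₃ y₂≢y₃)
    where
    chosen : ∀ y → Adj (T CT) x y → ∃[ b ] (b ∈ K CT y × b ∉ K CT x)
    chosen y xy = outside x y (adj⇒≢ (T CT) xy ∘ ≡-sym)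
    b : ∀ y → Adj (T CT) x y → Fin n
    b y xy = proj₁ (chosen y xy)
    b∈y : ∀ y xy → b y xy ∈ K CT y
    b∈y y xy = proj₁ (proj₂ (chosen y xy))
    b∉x : ∀ y xy → b y xy ∉ K CT x
    b∉x y xy = proj₂ (proj₂ (chosen y xy))
    -- v and b lie in the clique K y and differ since v ∈ K x.
    vAdj : ∀ y xy → v ∈ K CT y → Adj G v (b y xy)
    vAdj y xy v∈y = proj₁ (K-max CT y) v (b y xy) v∈y (b∈y y xy)
                      (λ v≡b → b∉x y xy (subst (_∈ K CT x) v≡b v∈x))
    distinct : ∀ y y′ xy xy′ → y ≢ y′ → b y xy ≢ b y′ xy′
    distinct y y′ xy xy′ y≢y′ b≡b′ =
      separated x y y′ _ _ xy xy′ y≢y′ (b∈y y xy) (b∉x y xy) (b∈y y′ xy′) (b∉x y′ xy′)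
        y′ (subst (_∈ K CT y′) (≡-sym b≡b′) (b∈y y′ xy′)) (b∈y y′ xy′)
    nonAdjacent : ∀ y y′ xy xy′ → y ≢ y′ → ¬ Adj G (b y xy) (b y′ xy′)
    nonAdjacent y y′ xy xy′ y≢y′ bb′ with edgeInMaxClique _ _ bb′
    ... | S , maximal , b∈S , b′∈S with K-all CT S maximal
    ... | z , refl = separated x y y′ _ _ xy xy′ y≢y′
                       (b∈y y xy) (b∉x y xy) (b∈y y′ xy′) (b∉x y′ xy′) z b∈S b′∈S

lemma3p1 : ∀ {n} (G : Graph n) → Chordal G → ClawFree G → (CT : CliqueTree G)
         → ∀ (v : Fin n) → InducedPath (T CT) (λ i → v ∈ K CT i)
lemma3p1 G _ clawFree CT v =
  BranchFree.inducedPath (T CT) acyclic containsV (λ i → v ∈? K CT i)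
    connected (InCliqueTree.noBranchPoint G CT clawFree v)
  where
  containsV : Fin (m CT) → Set
  containsV i = v ∈ K CT i
  acyclic : Acyclic (T CT)
  acyclic = proj₂ (T-tree CT)
  connected : ∀ i j → containsV i → containsV j → WalkIn (T CT) containsV i j
  connected = T-induced CT v
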